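{- Let $p$ be a prime and let $c$ be an integer written as $c=ap+b$ with $a,b\in\mathbb{Z}$ and $0\le b\le p-1$. Then $\bigl[c(\tfrac1p,0)+D\bigr]\cap\mathbb{Z}^2=\bigl[\{(a,0),\,(a+1,-p^2+pb)\}+D\bigr]\cap\mathbb{Z}^2.$
   Context: $D=\{(x,y)\in\mathbb{R}^2: x+py\le 0,\ p^2x+y\le 0\}$; sums denote Minkowski sums in $\mathbb{R}^2$. -}

module Defs where

open import Data.Nat using (ℕ)
open import Data.Nat.Base using (nonTrivial⇒nonZero)
open import Data.Nat.Primality using (Prime)
import Data.Nat.Primality
open import Data.Integer using (ℤ)
open import Data.Rational using (ℚ; _+_; _*_; _≤_; 0ℚ; _/_)
import Data.Rational as Q
open import Data.Product using (_×_; _,_; ∃)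
open import Relation.Binary.PropositionalEquality using (_≡_)

Pt : Set
Pt = ℚ × ℚ

Subset² : Set₁
Subset² = Pt → Set

_⊞_ : Pt → Pt → Pt
(x₁ , y₁) ⊞ (x₂ , y₂) = (x₁ + x₂ , y₁ + y₂)

_⊕_ : Subset² → Subset² → Subset²
(A ⊕ B) z = ∃ λ u → ∃ λ v → A u × B v × (z ≡ u ⊞ v)

⟦_⟧ : Pt → Subset²
⟦ u ⟧ z = z ≡ u

pair : Pt → Pt → Subset²
pair u v z = (z ≡ u) ⊎' (z ≡ v)
  where
  open import Data.Sum using () renaming (_⊎_ to _⊎'_)

ι : ℤ → ℚ
ι c = c / 1

ιₙ : ℕ → ℚ
ιₙ n = (Data.Integer.+ n) / 1
  where import Data.Integer

D : ℕ → Subset²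
D p (x , y) = (x + ιₙ p * y ≤ 0ℚ) × (ιₙ p * ιₙ p * x + y ≤ 0ℚ)

_over_ : ℤ → (p : ℕ) → {Prime p} → ℚ
(c over p) {pr} = go pr
  where
  go : Prime p → ℚ
  go (Data.Nat.Primality.prime {{nt}} _) = _/_ c p {{nonTrivial⇒nonZero p {{nt}}}}

_∋ℤ²_ : Subset² → ℤ × ℤ → Set
S ∋ℤ² (x , y) = S (ι x , ι y)

-- Write u = x - a. Scaling by p (D is a cone), an integer point (x, y) lies in c(1/p, 0) + D iff
-- u + p y ≤ b/p and p² u + y ≤ p b, and since 0 ≤ b < p the first condition is u + p y ≤ 0.
-- Everything rests on the identity p (p² u + y) = (p³ - 1) u + (u + p y). If u ≤ 0 it gives
-- p² u + y ≤ 0, so (x, y) ∈ (a, 0) + D. If u ≥ 1 it gives u + p y ≤ p² b - p³ + 1, which together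
-- with p² u + y ≤ p b says (x, y) ∈ (a + 1, -p² + p b) + D. Conversely both translates lie in
-- c(1/p, 0) + D.
module Submission where

open import Defs
open import Data.Nat using (ℕ)
open import Data.Nat.Primality using (Prime)
open import Data.Integer using (ℤ; +_; _+_; _*_; -_; _≤_; _<_; 1ℤ; 0ℤ)
open import Data.Rational using (0ℚ)
open import Data.Product using (_×_; _,_)
open import Function.Bundles using (_⇔_)
open import Relation.Binary.PropositionalEquality using (_≡_)

open import Data.Nat using (suc; NonZero; z≤n)
open import Data.Nat.Primality using (prime⇒nonZero)
open import Data.Integer using (+[1+_]; _-_; +≤+; Positive; positive; nonNegative)
open import Data.Integer.Properties
open import Data.Integer.Tactic.RingSolver using (solve)
import Data.Rational as ℚ
import Data.Rational.Properties as ℚₚ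
open import Data.Rational.Solver using (module +-*-Solver)
open import Data.Rational using (toℚᵘ)
import Data.Rational.Unnormalised as ℚᵘ
import Data.Rational.Unnormalised.Properties as ℚᵘₚ
open import Data.Rational.Unnormalised using (mkℚᵘ; *≡*; *≤*)
open import Data.List using (_∷_; [])
open import Data.Sum using (_⊎_; inj₁; inj₂)
open import Data.Product.Function.NonDependent.Propositional using (_×-⇔_)
open import Data.Sum.Function.Propositional using (_⊎-⇔_)
open import Function.Base using (_∘_)
open import Function.Bundles using (mk⇔; Equivalence)
open import Function.Properties.Equivalence using () renaming (sym to ⇔-sym; trans to ⇔-trans)
open import Function.Related.Propositional using (module EquationalReasoning; ≡⇒)
open import Relation.Binary.PropositionalEquality using (module ≡-Reasoning; refl; sym; trans; cong; cong₂; subst)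
open import Relation.Nullary using (yes; no; contradiction)

open Equivalence using (to; from)
open +-*-Solver using (_:+_; _:-_; _:*_; _:=_) renaming (solve to solveℚ)

nonZero⇒+pos : ∀ n .{{_ : NonZero n}} → Positive (+ n)
nonZero⇒+pos (suc _) = _

0≤i⇒j≤0⇒i*j≤0 : ∀ {i j} → 0ℤ ≤ i → j ≤ 0ℤ → i * j ≤ 0ℤ
0≤i⇒j≤0⇒i*j≤0 {i} 0≤i j≤0 = ≤-trans (*-monoˡ-≤-nonNeg i {{nonNegative 0≤i}} j≤0) (≤-reflexive (*-zeroʳ i))

pos*i≤0⇔i≤0 : ∀ k .{{_ : Positive k}} i → k * i ≤ 0ℤ ⇔ i ≤ 0ℤ
pos*i≤0⇔i≤0 k i = mk⇔
  (λ ki≤0 → *-cancelˡ-≤-pos i 0ℤ k (≤-trans ki≤0 (≤-reflexive (sym (*-zeroʳ k)))))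
  (0≤i⇒j≤0⇒i*j≤0 (<⇒≤ (positive⁻¹ k)))

1≤i*j : ∀ {i j} → 1ℤ ≤ i → 1ℤ ≤ j → 1ℤ ≤ i * j
1≤i*j {i} {j} 1≤i 1≤j = begin
  1ℤ     ≤⟨ 1≤i ⟩
  i      ≡⟨ *-identityʳ i ⟨
  i * 1ℤ ≤⟨ *-monoˡ-≤-nonNeg i {{nonNegative (≤-trans (+≤+ z≤n) 1≤i)}} 1≤j ⟩
  i * j  ∎
  where open ≤-Reasoning

0≤i*j : ∀ {i j} → 0ℤ ≤ i → 0ℤ ≤ j → 0ℤ ≤ i * j
0≤i*j {i} {j} 0≤i 0≤j = begin
  0ℤ     ≡⟨ *-zeroʳ i ⟨
  i * 0ℤ ≤⟨ *-monoˡ-≤-nonNeg i {{nonNegative 0≤i}} 0≤j ⟩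
  i * j  ∎
  where open ≤-Reasoning

<⇒1≤- : ∀ {i j} → i < j → 1ℤ ≤ j - i
<⇒1≤- {i} {j} i<j = begin
  1ℤ            ≡⟨ solve (i ∷ []) ⟩
  (1ℤ + i) - i  ≤⟨ +-monoˡ-≤ (- i) (i<j⇒suc[i]≤j i<j) ⟩
  j - i         ∎
  where open ≤-Reasoning

k*i≤r⇔i≤0 : ∀ {k r} i → 0ℤ ≤ r → r < k → k * i ≤ r ⇔ i ≤ 0ℤ
k*i≤r⇔i≤0 {k} {r} i 0≤r r<k = mk⇔ k*i≤r⇒i≤0 (λ i≤0 → ≤-trans (from (pos*i≤0⇔i≤0 k i) i≤0) 0≤r)
  where
  instance
    k-pos : Positive k
    k-pos = positive (≤-<-trans 0≤r r<k)
  k*i≤r⇒i≤0 : k * i ≤ r → i ≤ 0ℤ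
  k*i≤r⇒i≤0 ki≤r with i ≤? 0ℤ
  ... | yes i≤0 = i≤0
  ... | no i≰0 = contradiction (begin-strict
    k      ≡⟨ *-identityʳ k ⟨
    k * 1ℤ ≤⟨ *-monoˡ-≤-nonNeg k {{nonNegative (<⇒≤ (positive⁻¹ k))}} (i<j⇒suc[i]≤j (≰⇒> i≰0)) ⟩
    k * i  ≤⟨ ki≤r ⟩
    r      <⟨ r<k ⟩
    k      ∎) (<-irrefl refl)
    where open ≤-Reasoning

Dℤ : ℤ → ℤ × ℤ → Set
Dℤ P (u , v) = (u + P * v ≤ 0ℤ) × (P * P * u + v ≤ 0ℤ)

module _ (P : ℤ) .{{_ : Positive P}} {b : ℤ} (0≤b : 0ℤ ≤ b) (b<P : b < P) where

  Dℤ-dilated⇔ : ∀ u v → Dℤ P (P * u - b , P * v) ⇔ ((u + P * v ≤ 0ℤ) × (P * P * u + v ≤ P * b))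
  Dℤ-dilated⇔ u v = mk⇔
    (λ (h₁ , h₂) → to (k*i≤r⇔i≤0 (u + P * v) 0≤b b<P) (i-j≤0⇒i≤j (subst (_≤ 0ℤ) eq₁ h₁))
                  , i-j≤0⇒i≤j (to (pos*i≤0⇔i≤0 P _) (subst (_≤ 0ℤ) eq₂ h₂)))
    (λ (m≤0 , n≤Pb) → subst (_≤ 0ℤ) (sym eq₁) (i≤j⇒i-j≤0 (from (k*i≤r⇔i≤0 (u + P * v) 0≤b b<P) m≤0))
                    , subst (_≤ 0ℤ) (sym eq₂) (from (pos*i≤0⇔i≤0 P _) (i≤j⇒i-j≤0 n≤Pb)))
    where
    eq₁ : (P * u - b) + P * (P * v) ≡ P * (u + P * v) - b
    eq₁ = solve (P ∷ u ∷ v ∷ b ∷ [])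
    eq₂ : P * P * (P * u - b) + P * v ≡ P * (P * P * u + v - P * b)
    eq₂ = solve (P ∷ u ∷ v ∷ b ∷ [])

  Dℤ-dilated-split : ∀ u v →
    Dℤ P (P * u - b , P * v) ⇔ (Dℤ P (u , v) ⊎ Dℤ P (u - 1ℤ , v + (P * P - P * b)))
  Dℤ-dilated-split u v = mk⇔ (split ∘ to (Dℤ-dilated⇔ u v)) (from (Dℤ-dilated⇔ u v) ∘ merge)
    where
    open ≤-Reasoning
    1≤P : 1ℤ ≤ P
    1≤P = i<j⇒suc[i]≤j (positive⁻¹ P)
    0≤P³-1 : 0ℤ ≤ P * P * P - 1ℤ
    0≤P³-1 = i≤j⇒0≤j-i (1≤i*j (1≤i*j 1≤P 1≤P) 1≤P)
    0≤P²[P-b]-1 : 0ℤ ≤ P * P * (P - b) - 1ℤ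
    0≤P²[P-b]-1 = i≤j⇒0≤j-i (1≤i*j (1≤i*j 1≤P 1≤P) (<⇒1≤- b<P))

    split : (u + P * v ≤ 0ℤ) × (P * P * u + v ≤ P * b) → Dℤ P (u , v) ⊎ Dℤ P (u - 1ℤ , v + (P * P - P * b))
    split (m≤0 , n≤Pb) with u ≤? 0ℤ
    ... | yes u≤0 = inj₁ (m≤0 , to (pos*i≤0⇔i≤0 P _) (begin
      P * (P * P * u + v)                      ≡⟨ solve (P ∷ u ∷ v ∷ []) ⟩
      (P * P * P - 1ℤ) * u + (u + P * v)       ≤⟨ +-mono-≤ (0≤i⇒j≤0⇒i*j≤0 0≤P³-1 u≤0) m≤0 ⟩
      0ℤ                                       ∎))
    ... | no u≰0 = inj₂ ((begin
      (u - 1ℤ) + P * (v + (P * P - P * b))                ≡⟨ solve (P ∷ u ∷ v ∷ b ∷ []) ⟩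
      P * (P * P * u + v - P * b) - (P * P * P - 1ℤ) * (u - 1ℤ)
        ≤⟨ i-j≤i _ _ {{nonNegative (0≤i*j 0≤P³-1 (i≤j⇒0≤j-i (i<j⇒suc[i]≤j (≰⇒> u≰0))))}} ⟩
      P * (P * P * u + v - P * b)                         ≤⟨ from (pos*i≤0⇔i≤0 P _) (i≤j⇒i-j≤0 n≤Pb) ⟩
      0ℤ                                                  ∎) , (begin
      P * P * (u - 1ℤ) + (v + (P * P - P * b))            ≡⟨ solve (P ∷ u ∷ v ∷ b ∷ []) ⟩
      P * P * u + v - P * b                               ≤⟨ i≤j⇒i-j≤0 n≤Pb ⟩
      0ℤ                                                  ∎))

    merge : Dℤ P (u , v) ⊎ Dℤ P (u - 1ℤ , v + (P * P - P * b)) → (u + P * v ≤ 0ℤ) × (P * P * u + v ≤ P * b)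
    merge (inj₁ (m≤0 , n≤0)) = m≤0 , ≤-trans n≤0 (0≤i*j (<⇒≤ (positive⁻¹ P)) 0≤b)
    merge (inj₂ (h₁ , h₂)) = (begin
      u + P * v                                                             ≡⟨ solve (P ∷ u ∷ v ∷ b ∷ []) ⟩
      ((u - 1ℤ) + P * (v + (P * P - P * b))) - (P * P * (P - b) - 1ℤ)     ≤⟨ i-j≤i _ _ {{nonNegative 0≤P²[P-b]-1}} ⟩
      (u - 1ℤ) + P * (v + (P * P - P * b))                                  ≤⟨ h₁ ⟩
      0ℤ                                                                    ∎) , i-j≤0⇒i≤j (begin
      P * P * u + v - P * b                      ≡⟨ solve (P ∷ u ∷ v ∷ b ∷ []) ⟩
      P * P * (u - 1ℤ) + (v + (P * P - P * b))   ≤⟨ h₂ ⟩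
      0ℤ                                         ∎)

  Dℤ-split : ∀ a x y → Dℤ P (P * x - (a * P + b) , P * (y - 0ℤ))
                        ⇔ (Dℤ P (x - a , y - 0ℤ) ⊎ Dℤ P (x - (a + 1ℤ) , y - (- (P * P) + P * b)))
  Dℤ-split a x y = begin
    Dℤ P (P * x - (a * P + b) , P * (y - 0ℤ))
      ≡⟨ cong (Dℤ P) (cong₂ _,_ Px-c≡ (cong (P *_) (+-identityʳ y))) ⟩
    Dℤ P (P * (x - a) - b , P * y)
      ∼⟨ Dℤ-dilated-split (x - a) y ⟩
    (Dℤ P (x - a , y) ⊎ Dℤ P (x - a - 1ℤ , y + (P * P - P * b)))
      ≡⟨ cong₂ (λ w₁ w₂ → Dℤ P w₁ ⊎ Dℤ P w₂) (cong (x - a ,_) (sym (+-identityʳ y))) (cong₂ _,_ x-a-1≡ y+P²-Pb≡) ⟩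
    (Dℤ P (x - a , y - 0ℤ) ⊎ Dℤ P (x - (a + 1ℤ) , y - (- (P * P) + P * b))) ∎
    where
    open EquationalReasoning
    Px-c≡ : P * x - (a * P + b) ≡ P * (x - a) - b
    Px-c≡ = solve (P ∷ x ∷ a ∷ b ∷ [])
    x-a-1≡ : x - a - 1ℤ ≡ x - (a + 1ℤ)
    x-a-1≡ = solve (x ∷ a ∷ [])
    y+P²-Pb≡ : y + (P * P - P * b) ≡ y - (- (P * P) + P * b)
    y+P²-Pb≡ = solve (P ∷ y ∷ b ∷ [])

ι-toℚᵘ : ∀ m → toℚᵘ (ι m) ℚᵘ.≃ mkℚᵘ m 0
ι-toℚᵘ m = ℚₚ.toℚᵘ-fromℚᵘ (mkℚᵘ m 0)

ι-+ : ∀ m n → ι (m + n) ≡ ι m ℚ.+ ι n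
ι-+ m n = ℚₚ.toℚᵘ-injective (begin
  toℚᵘ (ι (m + n))                ≈⟨ ι-toℚᵘ (m + n) ⟩
  mkℚᵘ (m + n) 0                  ≈⟨ *≡* (cong (_* 1ℤ) (sym (cong₂ _+_ (*-identityʳ m) (*-identityʳ n)))) ⟩
  mkℚᵘ m 0 ℚᵘ.+ mkℚᵘ n 0          ≈⟨ ℚᵘₚ.+-cong (ι-toℚᵘ m) (ι-toℚᵘ n) ⟨
  toℚᵘ (ι m) ℚᵘ.+ toℚᵘ (ι n)      ≈⟨ ℚₚ.toℚᵘ-homo-+ (ι m) (ι n) ⟨
  toℚᵘ (ι m ℚ.+ ι n)              ∎)
  where open ℚᵘₚ.≃-Reasoning

ι-* : ∀ m n → ι (m * n) ≡ ι m ℚ.* ι n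
ι-* m n = ℚₚ.toℚᵘ-injective (begin
  toℚᵘ (ι (m * n))                ≈⟨ ι-toℚᵘ (m * n) ⟩
  mkℚᵘ (m * n) 0                  ≈⟨ *≡* refl ⟩
  mkℚᵘ m 0 ℚᵘ.* mkℚᵘ n 0          ≈⟨ ℚᵘₚ.*-cong (ι-toℚᵘ m) (ι-toℚᵘ n) ⟨
  toℚᵘ (ι m) ℚᵘ.* toℚᵘ (ι n)      ≈⟨ ℚₚ.toℚᵘ-homo-* (ι m) (ι n) ⟨
  toℚᵘ (ι m ℚ.* ι n)              ∎)
  where open ℚᵘₚ.≃-Reasoning

ι-neg : ∀ m → ι (- m) ≡ ℚ.- ι m
ι-neg m = ℚₚ.toℚᵘ-injective (begin
  toℚᵘ (ι (- m))        ≈⟨ ι-toℚᵘ (- m) ⟩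
  mkℚᵘ (- m) 0          ≈⟨ ℚᵘₚ.-‿cong (ι-toℚᵘ m) ⟨
  ℚᵘ.- toℚᵘ (ι m)       ≈⟨ ℚₚ.toℚᵘ-homo‿- (ι m) ⟨
  toℚᵘ (ℚ.- ι m)        ∎)
  where open ℚᵘₚ.≃-Reasoning

ι-- : ∀ m n → ι (m - n) ≡ ι m ℚ.- ι n
ι-- m n = trans (ι-+ m (- n)) (cong (ι m ℚ.+_) (ι-neg n))

ι-mono-≤ : ∀ {m n} → m ≤ n → ι m ℚ.≤ ι n
ι-mono-≤ {m} {n} m≤n = ℚₚ.toℚᵘ-cancel-≤ (begin
  toℚᵘ (ι m)   ≃⟨ ι-toℚᵘ m ⟩
  mkℚᵘ m 0     ≤⟨ *≤* (*-monoʳ-≤-nonNeg 1ℤ m≤n) ⟩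
  mkℚᵘ n 0     ≃⟨ ι-toℚᵘ n ⟨
  toℚᵘ (ι n)   ∎)
  where open ℚᵘₚ.≤-Reasoning

ι-cancel-≤ : ∀ {m n} → ι m ℚ.≤ ι n → m ≤ n
ι-cancel-≤ {m} {n} ιm≤ιn with ℚᵘₚ.≤-respʳ-≃ (ι-toℚᵘ n) (ℚᵘₚ.≤-respˡ-≃ (ι-toℚᵘ m) (ℚₚ.toℚᵘ-mono-≤ ιm≤ιn))
... | *≤* m*1≤n*1 = *-cancelʳ-≤-pos m n 1ℤ m*1≤n*1

ι-*-/ : ∀ c n .{{_ : NonZero n}} → ι (+ n) ℚ.* (c ℚ./ n) ≡ ι c
ι-*-/ c n@(suc k) = ℚₚ.toℚᵘ-injective (begin
  toℚᵘ (ι (+ n) ℚ.* (c ℚ./ n))              ≈⟨ ℚₚ.toℚᵘ-homo-* (ι (+ n)) (c ℚ./ n) ⟩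
  toℚᵘ (ι (+ n)) ℚᵘ.* toℚᵘ (c ℚ./ n)        ≈⟨ ℚᵘₚ.*-cong (ι-toℚᵘ (+ n)) (ℚₚ.toℚᵘ-fromℚᵘ (mkℚᵘ c k)) ⟩
  mkℚᵘ (+ n) 0 ℚᵘ.* mkℚᵘ c k                ≈⟨ *≡* (cross (+ n)) ⟩
  mkℚᵘ c 0                                  ≈⟨ ι-toℚᵘ c ⟨
  toℚᵘ (ι c)                                ∎)
  where
  open ℚᵘₚ.≃-Reasoning
  cross : ∀ m → (m * c) * 1ℤ ≡ c * (1ℤ * m)
  cross m = solve (m ∷ c ∷ [])

ι-positive : ∀ m .{{_ : Positive m}} → ℚ.Positive (ι m)
ι-positive +[1+ n ] = ℚₚ.normalize-pos (suc n) 1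

ι≤0⇔≤0 : ∀ m → ι m ℚ.≤ 0ℚ ⇔ m ≤ 0ℤ
ι≤0⇔≤0 m = mk⇔ ι-cancel-≤ ι-mono-≤

pos*q≤0⇔q≤0 : ∀ r .{{_ : ℚ.Positive r}} q → r ℚ.* q ℚ.≤ 0ℚ ⇔ q ℚ.≤ 0ℚ
pos*q≤0⇔q≤0 r q = mk⇔
  (λ rq≤0 → ℚₚ.*-cancelˡ-≤-pos r (ℚₚ.≤-trans rq≤0 (ℚₚ.≤-reflexive (sym (ℚₚ.*-zeroʳ r)))))
  (λ q≤0 → ℚₚ.≤-trans (ℚₚ.*-monoˡ-≤-nonNeg r {{ℚₚ.pos⇒nonNeg r}} q≤0) (ℚₚ.≤-reflexive (ℚₚ.*-zeroʳ r)))

_⊟_ : Pt → Pt → Pt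
(x₁ , y₁) ⊟ (x₂ , y₂) = (x₁ ℚ.- x₂ , y₁ ℚ.- y₂)

⟦⟧⊕⇔ : ∀ (S : Subset²) u z → (⟦ u ⟧ ⊕ S) z ⇔ S (z ⊟ u)
⟦⟧⊕⇔ S (s , t) (x , y) = mk⇔
  (λ { (_ , (v₁ , v₂) , refl , Sv , refl) → subst S (sym (cong₂ _,_ (cancel s v₁) (cancel t v₂))) Sv })
  (λ S[z⊟u] → (s , t) , (x ℚ.- s , y ℚ.- t) , refl , S[z⊟u] , cong₂ _,_ (restore s x) (restore t y))
  where
  cancel : ∀ s v → (s ℚ.+ v) ℚ.- s ≡ v
  cancel = solveℚ 2 (λ s v → (s :+ v) :- s := v) refl
  restore : ∀ s x → x ≡ s ℚ.+ (x ℚ.- s)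
  restore = solveℚ 2 (λ s x → x := s :+ (x :- s)) refl

pair⊕⇔ : ∀ (S : Subset²) u v z → (pair u v ⊕ S) z ⇔ ((⟦ u ⟧ ⊕ S) z ⊎ (⟦ v ⟧ ⊕ S) z)
pair⊕⇔ S u v z = mk⇔
  (λ { (u′ , w , inj₁ eq , Sw , z≡) → inj₁ (u′ , w , eq , Sw , z≡)
     ; (u′ , w , inj₂ eq , Sw , z≡) → inj₂ (u′ , w , eq , Sw , z≡) })
  (λ { (inj₁ (u′ , w , eq , Sw , z≡)) → u′ , w , inj₁ eq , Sw , z≡
     ; (inj₂ (u′ , w , eq , Sw , z≡)) → u′ , w , inj₂ eq , Sw , z≡ })

D-scale⇔ : ∀ p r .{{_ : ℚ.Positive r}} x y → D p (r ℚ.* x , r ℚ.* y) ⇔ D p (x , y)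
D-scale⇔ p r x y =
  ⇔-trans (≡⇒ (cong (ℚ._≤ 0ℚ) (eq₁ r (ιₙ p) x y))) (pos*q≤0⇔q≤0 r _)
  ×-⇔ ⇔-trans (≡⇒ (cong (ℚ._≤ 0ℚ) (eq₂ r (ιₙ p) x y))) (pos*q≤0⇔q≤0 r _)
  where
  eq₁ : ∀ r P x y → r ℚ.* x ℚ.+ P ℚ.* (r ℚ.* y) ≡ r ℚ.* (x ℚ.+ P ℚ.* y)
  eq₁ = solveℚ 4 (λ r P x y → r :* x :+ P :* (r :* y) := r :* (x :+ P :* y)) refl
  eq₂ : ∀ r P x y → P ℚ.* P ℚ.* (r ℚ.* x) ℚ.+ r ℚ.* y ≡ r ℚ.* (P ℚ.* P ℚ.* x ℚ.+ y)
  eq₂ = solveℚ 4 (λ r P x y → P :* P :* (r :* x) :+ r :* y := r :* (P :* P :* x :+ y)) refl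

-- ιₙ p and 0ℚ are ι (+ p) and ι 0ℤ by definition.
D-ι⇔ : ∀ p u v → D p (ι u , ι v) ⇔ Dℤ (+ p) (u , v)
D-ι⇔ p u v =
  ⇔-trans (≡⇒ (cong (ℚ._≤ 0ℚ) (sym eq₁))) (ι≤0⇔≤0 (u + P * v))
  ×-⇔ ⇔-trans (≡⇒ (cong (ℚ._≤ 0ℚ) (sym eq₂))) (ι≤0⇔≤0 (P * P * u + v))
  where
  P = + p
  eq₁ : ι (u + P * v) ≡ ι u ℚ.+ ι P ℚ.* ι v
  eq₁ = trans (ι-+ u (P * v)) (cong (ι u ℚ.+_) (ι-* P v))
  eq₂ : ι (P * P * u + v) ≡ ι P ℚ.* ι P ℚ.* ι u ℚ.+ ι v
  eq₂ = trans (ι-+ (P * P * u) v) (cong (ℚ._+ ι v) (trans (ι-* (P * P) u) (cong (ℚ._* ι u) (ι-* P P))))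

⟦ι⟧⊕D⇔ : ∀ p s t x y → (⟦ (ι s , ι t) ⟧ ⊕ D p) (ι x , ι y) ⇔ Dℤ (+ p) (x - s , y - t)
⟦ι⟧⊕D⇔ p s t x y = begin
  (⟦ (ι s , ι t) ⟧ ⊕ D p) (ι x , ι y)   ∼⟨ ⟦⟧⊕⇔ (D p) (ι s , ι t) (ι x , ι y) ⟩
  D p (ι x ℚ.- ι s , ι y ℚ.- ι t)       ≡⟨ cong (D p) (cong₂ _,_ (sym (ι-- x s)) (sym (ι-- y t))) ⟩
  D p (ι (x - s) , ι (y - t))           ∼⟨ D-ι⇔ p (x - s) (y - t) ⟩
  Dℤ (+ p) (x - s , y - t)              ∎
  where open EquationalReasoning

⟦/⟧⊕D⇔ : ∀ p .{{_ : NonZero p}} c t x y →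
  (⟦ (c ℚ./ p , ι t) ⟧ ⊕ D p) (ι x , ι y) ⇔ Dℤ (+ p) (+ p * x - c , + p * (y - t))
⟦/⟧⊕D⇔ p c t x y = let open EquationalReasoning in begin
  (⟦ (c ℚ./ p , ι t) ⟧ ⊕ D p) (ι x , ι y)         ∼⟨ ⟦⟧⊕⇔ (D p) (c ℚ./ p , ι t) (ι x , ι y) ⟩
  D p (ι x ℚ.- c ℚ./ p , ι y ℚ.- ι t)             ∼⟨ ⇔-sym (D-scale⇔ p (ι P) {{ι-positive P {{nonZero⇒+pos p}}}} _ _) ⟩
  D p (ι P ℚ.* (ι x ℚ.- c ℚ./ p) , ι P ℚ.* (ι y ℚ.- ι t))
                                                  ≡⟨ cong (D p) (cong₂ _,_ eq₁ eq₂) ⟩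
  D p (ι (P * x - c) , ι (P * (y - t)))           ∼⟨ D-ι⇔ p (P * x - c) (P * (y - t)) ⟩
  Dℤ P (P * x - c , P * (y - t))                  ∎
  where
  P = + p
  eq₁ : ι P ℚ.* (ι x ℚ.- c ℚ./ p) ≡ ι (P * x - c)
  eq₁ = begin
    ι P ℚ.* (ι x ℚ.- c ℚ./ p)               ≡⟨ solveℚ 3 (λ P X q → P :* (X :- q) := P :* X :- P :* q) refl (ι P) (ι x) (c ℚ./ p) ⟩
    ι P ℚ.* ι x ℚ.- ι P ℚ.* (c ℚ./ p)       ≡⟨ cong₂ ℚ._-_ (sym (ι-* P x)) (ι-*-/ c p) ⟩
    ι (P * x) ℚ.- ι c                       ≡⟨ ι-- (P * x) c ⟨
    ι (P * x - c)                           ∎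
    where open ≡-Reasoning
  eq₂ : ι P ℚ.* (ι y ℚ.- ι t) ≡ ι (P * (y - t))
  eq₂ = trans (cong (ι P ℚ.*_) (sym (ι-- y t))) (sym (ι-* P (y - t)))

lemma3p1 : (p : ℕ) → (pr : Prime p) → (a b c : ℤ) → c ≡ a * + p + b → 0ℤ ≤ b → b < + p →
    (z : ℤ × ℤ) →
      ((⟦ ((c over p) {pr} , 0ℚ) ⟧ ⊕ D p) ∋ℤ² z)
        ⇔ ((pair (ι a , 0ℚ) (ι (a + 1ℤ) , ι (- (+ p * + p) + + p * b)) ⊕ D p) ∋ℤ² z)
-- (c over p) {pr} computes to c / p, and 0ℚ is ι 0ℤ by definition.
lemma3p1 p pr a b c refl 0≤b b<p (x , y) = begin
  (⟦ (c ℚ./ p , ι 0ℤ) ⟧ ⊕ D p) (ι x , ι y)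
    ∼⟨ ⟦/⟧⊕D⇔ p c 0ℤ x y ⟩
  Dℤ P (P * x - c , P * (y - 0ℤ))
    ∼⟨ Dℤ-split P 0≤b b<p a x y ⟩
  (Dℤ P (x - a , y - 0ℤ) ⊎ Dℤ P (x - (a + 1ℤ) , y - T))
    ∼⟨ ⇔-sym (⟦ι⟧⊕D⇔ p a 0ℤ x y) ⊎-⇔ ⇔-sym (⟦ι⟧⊕D⇔ p (a + 1ℤ) T x y) ⟩
  ((⟦ (ι a , ι 0ℤ) ⟧ ⊕ D p) (ι x , ι y) ⊎ (⟦ (ι (a + 1ℤ) , ι T) ⟧ ⊕ D p) (ι x , ι y))
    ∼⟨ ⇔-sym (pair⊕⇔ (D p) (ι a , ι 0ℤ) (ι (a + 1ℤ) , ι T) (ι x , ι y)) ⟩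
  (pair (ι a , ι 0ℤ) (ι (a + 1ℤ) , ι T) ⊕ D p) (ι x , ι y) ∎
  where
  open EquationalReasoning
  instance
    p≢0 : NonZero p
    p≢0 = prime⇒nonZero pr
    P-pos : Positive (+ p)
    P-pos = nonZero⇒+pos p
  P = + p
  T = - (P * P) + P * b
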